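{- Let $G_1, G_2$ be finite, undirected, connected graphs (self-loops allowed), each with $n$ nodes, and let $\mathbf{M}_1$ and $\mathbf{M}_2$ be their adjacency matrices. Let $\mathbf{M}$ be the adjacency matrix of the disjoint union $G_1 \cup G_2$, written as the $2n\times 2n$ block matrix $$\mathbf{M} = \begin{pmatrix} \mathbf{M}_1 & \mathbf{0}_n \\ \mathbf{0}_n & \mathbf{M}_2 \end{pmatrix}.$$ Then $G_1$ and $G_2$ are isomorphic if and only if there exist a $2n \times 2n$ permutation matrix $\mathbf{P}$ and an $n \times n$ binary matrix $\mathbf{B}$ such that $$\mathbf{P}^{T} \mathbf{M} \mathbf{P} = \mathbf{I}_2 \otimes \mathbf{B},$$ where $\mathbf{I}_2$ is the $2\times 2$ identity matrix and $\otimes$ is the Kronecker product of matrices.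
   Context: For a graph $G$ with nodes $v_1,\dots,v_n$, its adjacency matrix is the $n\times n$ binary matrix with $(i,j)$ entry equal to $1$ iff $\{v_i,v_j\}$ is an edge (a self-loop $\{v_i,v_i\}$ gives a $1$ on the diagonal). $\mathbf{0}_n$ denotes the $n\times n$ zero matrix. The disjoint union $G_1\cup G_2$ has node set $V(G_1)\cup V(G_2)$ (disjoint) and edge set $E(G_1)\cup E(G_2)$. For an $a\times b$ matrix $\mathbf{A}=(a_{ij})$ and a matrix $\mathbf{B}$, the Kronecker product $\mathbf{A}\otimes\mathbf{B}$ is the block matrix whose $(i,j)$ block is $a_{ij}\mathbf{B}$. -}

module Defs where

open import Data.Nat using (ℕ; zero; suc; _+_; _*_)
open import Data.Nat.Properties using (+-identityʳ)
open import Data.Bool using (Bool; true; false; if_then_else_)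
open import Data.Fin using (Fin; splitAt; remQuot; cast; _≟_)
open import Data.Fin.Permutation using (Permutation′; _⟨$⟩ʳ_)
open import Data.Sum using (_⊎_; inj₁; inj₂)
open import Data.Product using (Σ; ∃; _,_; proj₁; proj₂)
open import Relation.Nullary.Decidable using (⌊_⌋)
open import Relation.Binary.PropositionalEquality using (_≡_; refl; cong) renaming (sym to ≡-sym)

record Graph (n : ℕ) : Set where
  field
    adj : Fin n → Fin n → Bool
    sym : ∀ i j → adj i j ≡ adj j i
open Graph public

data Reach {n : ℕ} (G : Graph n) : Fin n → Fin n → Set where
  here : ∀ {i} → Reach G i i
  step : ∀ {i k j} → adj G i k ≡ true → Reach G k j → Reach G i j

Connected : ∀ {n} → Graph n → Set
Connected {n} G = ∀ (i j : Fin n) → Reach G i j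

Isomorphic : ∀ {n} → Graph n → Graph n → Set
Isomorphic {n} G H =
  Σ (Permutation′ n) λ σ → ∀ (i j : Fin n) → adj G i j ≡ adj H (σ ⟨$⟩ʳ i) (σ ⟨$⟩ʳ j)

unionAdj : ∀ {n} → Graph n → Graph n → Fin (n + n) → Fin (n + n) → Bool
unionAdj {n} G H i j with splitAt n i | splitAt n j
... | inj₁ a | inj₁ b = adj G a b
... | inj₁ a | inj₂ b = false
... | inj₂ a | inj₁ b = false
... | inj₂ a | inj₂ b = adj H a b

unionSym : ∀ {n} (G H : Graph n) i j → unionAdj G H i j ≡ unionAdj G H j i
unionSym {n} G H i j with splitAt n i | splitAt n j
... | inj₁ a | inj₁ b = Graph.sym G a b
... | inj₁ a | inj₂ b = refl
... | inj₂ a | inj₁ b = refl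
... | inj₂ a | inj₂ b = Graph.sym H a b

_∪ᴳ_ : ∀ {n} → Graph n → Graph n → Graph (n + n)
G ∪ᴳ H = record { adj = unionAdj G H ; sym = unionSym G H }

Mat : ℕ → ℕ → Set
Mat m k = Fin m → Fin k → ℕ

Binary : ∀ {m k} → Mat m k → Set
Binary {m} {k} A = ∀ (i : Fin m) (j : Fin k) → A i j ≡ 0 ⊎ A i j ≡ 1

Σ[<_]_ : (n : ℕ) → (Fin n → ℕ) → ℕ
Σ[< zero ] f = 0
Σ[< suc n ] f = f Fin.zero + Σ[< n ] (λ i → f (Fin.suc i))
  where import Data.Fin as Fin

adjMatrix : ∀ {n} → Graph n → Mat n n
adjMatrix G i j = if adj G i j then 1 else 0

transpose : ∀ {m k} → Mat m k → Mat k m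
transpose A i j = A j i

_·ₘ_ : ∀ {m k l} → Mat m k → Mat k l → Mat m l
_·ₘ_ {k = k} A B i j = Σ[< k ] (λ r → A i r * B r j)

identity : ∀ n → Mat n n
identity n i j = if ⌊ i ≟ j ⌋ then 1 else 0

permMatrix : ∀ {n} → Permutation′ n → Mat n n
permMatrix σ i j = if ⌊ σ ⟨$⟩ʳ i ≟ j ⌋ then 1 else 0

IsPermutationMatrix : ∀ {n} → Mat n n → Set
IsPermutationMatrix {n} P = Σ (Permutation′ n) λ σ → ∀ i j → P i j ≡ permMatrix σ i j

-- Kronecker product: (A ⊗ B) block (i,j) is a_ij B
_⊗ₘ_ : ∀ {a b c d} → Mat a b → Mat c d → Mat (a * c) (b * d)
_⊗ₘ_ {a} {b} {c} {d} A B x y =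
  A (proj₁ (remQuot {a} c x)) (proj₁ (remQuot {b} d y)) * B (proj₂ (remQuot {a} c x)) (proj₂ (remQuot {b} d y))

2*n≡n+n : ∀ n → 2 * n ≡ n + n
2*n≡n+n n = cong (n +_) (+-identityʳ n)

n+n≡2*n : ∀ n → n + n ≡ 2 * n
n+n≡2*n n = ≡-sym (2*n≡n+n n)

-- Pᵀ M P is M with rows and columns renumbered by the permutation of P, so the condition
-- says that some relabelling of G₁ ∪ G₂ has adjacency matrix diag(B, B). If σ : G₁ ≅ G₂,
-- relabel the first block by σ⁻¹ and take B = M₂. Conversely, the relabelled graph has no
-- edges between its two blocks, so the block into which a node is sent is constant along
-- edges, hence constant on G₁ and on G₂ by connectedness; the two values differ because
-- both blocks are hit. Up to swapping the blocks, the relabelling therefore restricts to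
-- bijections of G₁ and of G₂ onto the nodes of B, and equality of the two diagonal blocks
-- turns them into an isomorphism G₁ ≅ G₂.

module Submission where

open import Defs hiding (sym)
open import Data.Bool using (Bool; true; false; not; if_then_else_)
open import Data.Bool.Properties using (¬-not; not-involutive) renaming (_≟_ to _≟ᵇ_)
open import Data.Fin using (Fin; zero; suc; toℕ; cast; _↑ˡ_; _↑ʳ_; splitAt; join; combine; _≟_)
open import Data.Fin.Patterns using (0F; 1F)
open import Data.Fin.Properties
  using (toℕ-injective; toℕ-cast; toℕ-↑ˡ; toℕ-↑ʳ; splitAt-↑ˡ; splitAt-↑ʳ; splitAt-join; join-splitAt;
         splitAt⁻¹-↑ˡ; splitAt⁻¹-↑ʳ; ↑ˡ-injective; ↑ʳ-injective; remQuot-combine)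
open import Data.Fin.Permutation
  using (Permutation; Permutation′; _⟨$⟩ʳ_; _⟨$⟩ˡ_; inverseˡ; inverseʳ; permutation; flip; _∘ₚ_; _≈_)
import Data.Fin.Permutation as Perm
open import Data.Nat using (ℕ; zero; suc; _+_; _*_)
open import Data.Nat.Properties using (*-comm; *-identityˡ; +-identityʳ)
open import Data.Product using (Σ; ∃₂; _×_; _,_; proj₁; proj₂)
open import Data.Sum using (_⊎_; inj₁; inj₂)
import Data.Sum as Sum
open import Data.Sum.Properties using (swap-involutive; map-map; map-cong; map-id)
open import Function using (_∘_; id)
open import Function.Bundles using (_⇔_; mk⇔)
open import Relation.Nullary using (yes; no; contradiction)
open import Relation.Binary.PropositionalEquality
open ≡-Reasoning

Σ-cong : ∀ k {f g : Fin k → ℕ} → (∀ r → f r ≡ g r) → Σ[< k ] f ≡ Σ[< k ] g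
Σ-cong zero    f≡g = refl
Σ-cong (suc k) f≡g = cong₂ _+_ (f≡g zero) (Σ-cong k (f≡g ∘ suc))

Σ-zero : ∀ k → Σ[< k ] (λ _ → 0) ≡ 0
Σ-zero zero    = refl
Σ-zero (suc k) = Σ-zero k

Σ-identity : ∀ k (f : Fin k → ℕ) c → Σ[< k ] (λ r → identity k r c * f r) ≡ f c
Σ-identity (suc k) f zero = begin
  f zero + 0 + Σ[< k ] (λ _ → 0) ≡⟨ cong₂ _+_ (+-identityʳ (f zero)) (Σ-zero k) ⟩
  f zero + 0                     ≡⟨ +-identityʳ (f zero) ⟩
  f zero                         ∎
Σ-identity (suc k) f (suc c) = trans (Σ-cong k (λ r → cong (_* f (suc r)) (identity-suc r c))) (Σ-identity k (f ∘ suc) c)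
  where
  identity-suc : ∀ r c → identity (suc k) (suc r) (suc c) ≡ identity k r c
  identity-suc r c with r ≟ c
  ... | yes _ = refl
  ... | no _  = refl

permMatrix-identity : ∀ {n} (σ : Permutation′ n) r i → permMatrix σ r i ≡ identity n r (σ ⟨$⟩ˡ i)
permMatrix-identity σ r i with σ ⟨$⟩ʳ r ≟ i | r ≟ σ ⟨$⟩ˡ i
... | yes _   | yes _   = refl
... | no _    | no _    = refl
... | yes σr≡i | no r≢σ⁻¹i = contradiction (trans (sym (inverseˡ σ)) (cong (σ ⟨$⟩ˡ_) σr≡i)) r≢σ⁻¹i
... | no σr≢i | yes r≡σ⁻¹i = contradiction (trans (cong (σ ⟨$⟩ʳ_) r≡σ⁻¹i) (inverseʳ σ)) σr≢i

conjugate-permMatrix : ∀ {n} {P : Mat n n} (σ : Permutation′ n) → (∀ i j → P i j ≡ permMatrix σ i j) →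
  (M : Mat n n) (i j : Fin n) → ((transpose P ·ₘ M) ·ₘ P) i j ≡ M (σ ⟨$⟩ˡ i) (σ ⟨$⟩ˡ j)
conjugate-permMatrix {n} {P} σ P≡σ M i j = begin
  Σ[< n ] (λ s → (transpose P ·ₘ M) i s * P s j) ≡⟨ Σ-cong n (λ s → cong₂ _*_ (row s) (P-entry s j)) ⟩
  Σ[< n ] (λ s → M i′ s * identity n s j′)       ≡⟨ Σ-cong n (λ s → *-comm (M i′ s) _) ⟩
  Σ[< n ] (λ s → identity n s j′ * M i′ s)       ≡⟨ Σ-identity n (M i′) j′ ⟩
  M i′ j′                                        ∎
  where
  i′ j′ : Fin n
  i′ = σ ⟨$⟩ˡ i
  j′ = σ ⟨$⟩ˡ j
  P-entry : ∀ r k → P r k ≡ identity n r (σ ⟨$⟩ˡ k)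
  P-entry r k = trans (P≡σ r k) (permMatrix-identity σ r k)
  row : ∀ s → (transpose P ·ₘ M) i s ≡ M i′ s
  row s = trans (Σ-cong n (λ r → cong (_* M r s) (P-entry r i))) (Σ-identity n (λ r → M r s) i′)

data Split (m n : ℕ) : Fin (m + n) → Set where
  left  : (a : Fin m) → Split m n (a ↑ˡ n)
  right : (b : Fin n) → Split m n (m ↑ʳ b)

split : ∀ m {n} (x : Fin (m + n)) → Split m n x
split m x with splitAt m x in eq
... | inj₁ a = subst (Split m _) (splitAt⁻¹-↑ˡ eq) (left a)
... | inj₂ b = subst (Split m _) (splitAt⁻¹-↑ʳ eq) (right b)

isLeft : ∀ m {n} → Fin (m + n) → Bool
isLeft m x = Sum.[ (λ _ → true) , (λ _ → false) ] (splitAt m x)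

isLeft-↑ˡ : ∀ {m} n (a : Fin m) → isLeft m (a ↑ˡ n) ≡ true
isLeft-↑ˡ {m} n a = cong (Sum.[ (λ _ → true) , (λ _ → false) ]) (splitAt-↑ˡ m a n)

isLeft-↑ʳ : ∀ m {n} (b : Fin n) → isLeft m (m ↑ʳ b) ≡ false
isLeft-↑ʳ m {n} b = cong (Sum.[ (λ _ → true) , (λ _ → false) ]) (splitAt-↑ʳ m n b)

-- The default passed to fromInj₁ / fromInj₂ is junk, reached only if f moves the node across blocks.
restrictˡ : ∀ {m n} → (Fin (m + n) → Fin (m + n)) → Fin m → Fin m
restrictˡ {m} {n} f a = Sum.fromInj₁ (λ _ → a) (splitAt m (f (a ↑ˡ n)))

restrictʳ : ∀ {m n} → (Fin (m + n) → Fin (m + n)) → Fin n → Fin n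
restrictʳ {m} {n} f b = Sum.fromInj₂ (λ _ → b) (splitAt m (f (m ↑ʳ b)))

module _ {m n : ℕ} (f : Fin (m + n) → Fin (m + n)) (keep : ∀ x → isLeft m (f x) ≡ isLeft m x) where

  restrictˡ-↑ˡ : ∀ a → f (a ↑ˡ n) ≡ restrictˡ f a ↑ˡ n
  restrictˡ-↑ˡ a with splitAt m (f (a ↑ˡ n)) in eq | keep (a ↑ˡ n)
  ... | inj₁ c | _    = sym (splitAt⁻¹-↑ˡ eq)
  ... | inj₂ c | crossed = contradiction (trans crossed (isLeft-↑ˡ n a)) λ ()

  restrictʳ-↑ʳ : ∀ b → f (m ↑ʳ b) ≡ m ↑ʳ restrictʳ f b
  restrictʳ-↑ʳ b with splitAt m (f (m ↑ʳ b)) in eq | keep (m ↑ʳ b)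
  ... | inj₂ c | _    = sym (splitAt⁻¹-↑ʳ eq)
  ... | inj₁ c | crossed = contradiction (trans crossed (isLeft-↑ʳ m b)) λ ()

blockMap : ∀ {m n} → (Fin m → Fin m) → (Fin n → Fin n) → Fin (m + n) → Fin (m + n)
blockMap {m} {n} f g x = join m n (Sum.map f g (splitAt m x))

module _ {m n : ℕ} where

  blockMap-↑ˡ : ∀ (f : Fin m → Fin m) (g : Fin n → Fin n) a → blockMap f g (a ↑ˡ n) ≡ f a ↑ˡ n
  blockMap-↑ˡ f g a = cong (join m n ∘ Sum.map f g) (splitAt-↑ˡ m a n)

  blockMap-↑ʳ : ∀ (f : Fin m → Fin m) (g : Fin n → Fin n) b → blockMap f g (m ↑ʳ b) ≡ m ↑ʳ g b
  blockMap-↑ʳ f g b = cong (join m n ∘ Sum.map f g) (splitAt-↑ʳ m n b)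

  blockMap-inverse : ∀ {f f′ : Fin m → Fin m} {g g′ : Fin n → Fin n} →
    (∀ a → f (f′ a) ≡ a) → (∀ b → g (g′ b) ≡ b) → ∀ x → blockMap f g (blockMap f′ g′ x) ≡ x
  blockMap-inverse {f} {f′} {g} {g′} ff′ gg′ x = begin
    join m n (Sum.map f g (splitAt m (join m n (Sum.map f′ g′ s))))
      ≡⟨ cong (join m n ∘ Sum.map f g) (splitAt-join m n (Sum.map f′ g′ s)) ⟩
    join m n (Sum.map f g (Sum.map f′ g′ s))                       ≡⟨ cong (join m n) (map-map s) ⟩
    join m n (Sum.map (f ∘ f′) (g ∘ g′) s)                         ≡⟨ cong (join m n) (map-cong ff′ gg′ s) ⟩
    join m n (Sum.map id id s)                                     ≡⟨ cong (join m n) (map-id s) ⟩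
    join m n s                                                     ≡⟨ join-splitAt m n x ⟩
    x                                                              ∎
    where
    s : Fin m ⊎ Fin n
    s = splitAt m x

infixr 7 _⊕ₚ_

_⊕ₚ_ : ∀ {m n} → Permutation′ m → Permutation′ n → Permutation′ (m + n)
σ ⊕ₚ τ = permutation (blockMap (σ ⟨$⟩ʳ_) (τ ⟨$⟩ʳ_)) (blockMap (σ ⟨$⟩ˡ_) (τ ⟨$⟩ˡ_))
  (blockMap-inverse (λ _ → inverseʳ σ) (λ _ → inverseʳ τ))
  (blockMap-inverse (λ _ → inverseˡ σ) (λ _ → inverseˡ τ))

module _ {m n : ℕ} (f g : Fin (m + n) → Fin (m + n))
         (keep-f : ∀ x → isLeft m (f x) ≡ isLeft m x) (keep-g : ∀ x → isLeft m (g x) ≡ isLeft m x)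
         (f∘g≗id : ∀ x → f (g x) ≡ x) where

  restrictˡ-inverse : ∀ a → restrictˡ f (restrictˡ g a) ≡ a
  restrictˡ-inverse a = ↑ˡ-injective n _ _ (begin
    restrictˡ f (restrictˡ g a) ↑ˡ n ≡⟨ restrictˡ-↑ˡ f keep-f _ ⟨
    f (restrictˡ g a ↑ˡ n)           ≡⟨ cong f (restrictˡ-↑ˡ g keep-g a) ⟨
    f (g (a ↑ˡ n))                   ≡⟨ f∘g≗id _ ⟩
    a ↑ˡ n                           ∎)

  restrictʳ-inverse : ∀ b → restrictʳ f (restrictʳ g b) ≡ b
  restrictʳ-inverse b = ↑ʳ-injective m _ _ (begin
    m ↑ʳ restrictʳ f (restrictʳ g b) ≡⟨ restrictʳ-↑ʳ {m} f keep-f _ ⟨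
    f (m ↑ʳ restrictʳ g b)           ≡⟨ cong f (restrictʳ-↑ʳ {m} g keep-g b) ⟨
    f (g (m ↑ʳ b))                   ≡⟨ f∘g≗id _ ⟩
    m ↑ʳ b                           ∎)

module _ {m n : ℕ} (π : Permutation′ (m + n)) (keep : ∀ x → isLeft m (π ⟨$⟩ʳ x) ≡ isLeft m x) where

  private
    keep⁻¹ : ∀ x → isLeft m (π ⟨$⟩ˡ x) ≡ isLeft m x
    keep⁻¹ x = trans (sym (keep _)) (cong (isLeft m) (inverseʳ π))

  restrictˡₚ : Permutation′ m
  restrictˡₚ = permutation (restrictˡ (π ⟨$⟩ʳ_)) (restrictˡ (π ⟨$⟩ˡ_))
    (restrictˡ-inverse _ _ keep keep⁻¹ (λ _ → inverseʳ π)) (restrictˡ-inverse _ _ keep⁻¹ keep (λ _ → inverseˡ π))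

  restrictʳₚ : Permutation′ n
  restrictʳₚ = permutation (restrictʳ (π ⟨$⟩ʳ_)) (restrictʳ (π ⟨$⟩ˡ_))
    (restrictʳ-inverse _ _ keep keep⁻¹ (λ _ → inverseʳ π)) (restrictʳ-inverse _ _ keep⁻¹ keep (λ _ → inverseˡ π))

  side-preserving⇒⊕ₚ : ∃₂ λ (σ : Permutation′ m) (τ : Permutation′ n) → π ≈ σ ⊕ₚ τ
  side-preserving⇒⊕ₚ = restrictˡₚ , restrictʳₚ , π≈⊕ₚ
    where
    π≈⊕ₚ : π ≈ restrictˡₚ ⊕ₚ restrictʳₚ
    π≈⊕ₚ x with split m x
    ... | left a  = trans (restrictˡ-↑ˡ (π ⟨$⟩ʳ_) keep a)
                          (sym (blockMap-↑ˡ (restrictˡₚ ⟨$⟩ʳ_) (restrictʳₚ ⟨$⟩ʳ_) a))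
    ... | right b = trans (restrictʳ-↑ʳ {m} (π ⟨$⟩ʳ_) keep b)
                          (sym (blockMap-↑ʳ (restrictˡₚ ⟨$⟩ʳ_) (restrictʳₚ ⟨$⟩ʳ_) b))

flip-cong : ∀ {m n} (π ρ : Permutation m n) → π ≈ ρ → flip π ≈ flip ρ
flip-cong π ρ π≈ρ y = begin
  π ⟨$⟩ˡ y                       ≡⟨ cong (π ⟨$⟩ˡ_) (inverseʳ ρ) ⟨
  π ⟨$⟩ˡ (ρ ⟨$⟩ʳ (ρ ⟨$⟩ˡ y))     ≡⟨ cong (π ⟨$⟩ˡ_) (π≈ρ _) ⟨
  π ⟨$⟩ˡ (π ⟨$⟩ʳ (ρ ⟨$⟩ˡ y))     ≡⟨ inverseˡ π ⟩
  ρ ⟨$⟩ˡ y                       ∎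

swapBlocks : ∀ m n → Fin (m + n) → Fin (n + m)
swapBlocks m n x = join n m (Sum.swap (splitAt m x))

module _ {m n : ℕ} where

  swapBlocks-↑ˡ : ∀ (a : Fin m) → swapBlocks m n (a ↑ˡ n) ≡ n ↑ʳ a
  swapBlocks-↑ˡ a = cong (join n m ∘ Sum.swap) (splitAt-↑ˡ m a n)

  swapBlocks-↑ʳ : ∀ (b : Fin n) → swapBlocks m n (m ↑ʳ b) ≡ b ↑ˡ m
  swapBlocks-↑ʳ b = cong (join n m ∘ Sum.swap) (splitAt-↑ʳ m n b)

  swapBlocks-involutive : ∀ x → swapBlocks n m (swapBlocks m n x) ≡ x
  swapBlocks-involutive x = begin
    join m n (Sum.swap (splitAt n (join n m (Sum.swap s)))) ≡⟨ cong (join m n ∘ Sum.swap) (splitAt-join n m (Sum.swap s)) ⟩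
    join m n (Sum.swap (Sum.swap s))                        ≡⟨ cong (join m n) (swap-involutive s) ⟩
    join m n s                                              ≡⟨ join-splitAt m n x ⟩
    x                                                       ∎
    where
    s : Fin m ⊎ Fin n
    s = splitAt m x

  isLeft-swapBlocks : ∀ x → isLeft n (swapBlocks m n x) ≡ not (isLeft m x)
  isLeft-swapBlocks x with split m x
  ... | left a  = trans (cong (isLeft n) (swapBlocks-↑ˡ a)) (trans (isLeft-↑ʳ n a) (cong not (sym (isLeft-↑ˡ n a))))
  ... | right b = trans (cong (isLeft n) (swapBlocks-↑ʳ b)) (trans (isLeft-↑ˡ m b) (cong not (sym (isLeft-↑ʳ m b))))

swapₚ : ∀ {m n} → Permutation (m + n) (n + m)
swapₚ {m} {n} = permutation (swapBlocks m n) (swapBlocks n m) (swapBlocks-involutive {n} {m}) (swapBlocks-involutive {m} {n})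

module _ {n : ℕ} (G H : Graph n) where

  adj-∪ᴳ-ˡˡ : ∀ a b → adj (G ∪ᴳ H) (a ↑ˡ n) (b ↑ˡ n) ≡ adj G a b
  adj-∪ᴳ-ˡˡ a b rewrite splitAt-↑ˡ n a n | splitAt-↑ˡ n b n = refl

  adj-∪ᴳ-ˡʳ : ∀ a b → adj (G ∪ᴳ H) (a ↑ˡ n) (n ↑ʳ b) ≡ false
  adj-∪ᴳ-ˡʳ a b rewrite splitAt-↑ˡ n a n | splitAt-↑ʳ n n b = refl

  adj-∪ᴳ-ʳˡ : ∀ a b → adj (G ∪ᴳ H) (n ↑ʳ a) (b ↑ˡ n) ≡ false
  adj-∪ᴳ-ʳˡ a b rewrite splitAt-↑ʳ n n a | splitAt-↑ˡ n b n = refl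

  adj-∪ᴳ-ʳʳ : ∀ a b → adj (G ∪ᴳ H) (n ↑ʳ a) (n ↑ʳ b) ≡ adj H a b
  adj-∪ᴳ-ʳʳ a b rewrite splitAt-↑ʳ n n a | splitAt-↑ʳ n n b = refl

  reach-↑ˡ : ∀ {a b} → Reach G a b → Reach (G ∪ᴳ H) (a ↑ˡ n) (b ↑ˡ n)
  reach-↑ˡ here       = here
  reach-↑ˡ (step e r) = step (trans (adj-∪ᴳ-ˡˡ _ _) e) (reach-↑ˡ r)

  reach-↑ʳ : ∀ {a b} → Reach H a b → Reach (G ∪ᴳ H) (n ↑ʳ a) (n ↑ʳ b)
  reach-↑ʳ here       = here
  reach-↑ʳ (step e r) = step (trans (adj-∪ᴳ-ʳʳ _ _) e) (reach-↑ʳ r)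

reach-invariant : ∀ {n} {A : Set} (G : Graph n) (f : Fin n → A) →
  (∀ {i j} → adj G i j ≡ true → f i ≡ f j) → ∀ {i j} → Reach G i j → f i ≡ f j
reach-invariant G f inv here       = refl
reach-invariant G f inv (step e r) = trans (inv e) (reach-invariant G f inv r)

common-relabelling⇒isomorphic : ∀ {n} (G H : Graph n) (σ τ : Permutation′ n) →
  (∀ a b → adj G (σ ⟨$⟩ʳ a) (σ ⟨$⟩ʳ b) ≡ adj H (τ ⟨$⟩ʳ a) (τ ⟨$⟩ʳ b)) → Isomorphic G H
common-relabelling⇒isomorphic G H σ τ eq = flip σ ∘ₚ τ , λ i j → begin
  adj G i j                                       ≡⟨ cong₂ (adj G) (inverseʳ σ) (inverseʳ σ) ⟨
  adj G (σ ⟨$⟩ʳ (σ ⟨$⟩ˡ i)) (σ ⟨$⟩ʳ (σ ⟨$⟩ˡ j)) ≡⟨ eq _ _ ⟩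
  adj H (τ ⟨$⟩ʳ (σ ⟨$⟩ˡ i)) (τ ⟨$⟩ʳ (σ ⟨$⟩ˡ j)) ∎

bit : Bool → ℕ
bit b = if b then 1 else 0

bit-injective : ∀ b c → bit b ≡ bit c → b ≡ c
bit-injective true  true  _ = refl
bit-injective false false _ = refl

adjMatrix-binary : ∀ {n} (G : Graph n) → Binary (adjMatrix G)
adjMatrix-binary G i j with adj G i j
... | true  = inj₂ refl
... | false = inj₁ refl

blockDiag : ∀ {n} → Mat n n → Mat (n + n) (n + n)
blockDiag {n} B i j = (identity 2 ⊗ₘ B) (cast (n+n≡2*n n) i) (cast (n+n≡2*n n) j)

⊗ₘ-combine : ∀ {a b c d} (A : Mat a b) (B : Mat c d) i j k l →
  (A ⊗ₘ B) (combine i k) (combine j l) ≡ A i j * B k l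
⊗ₘ-combine A B i j k l =
  cong₂ (λ u v → A (proj₁ u) (proj₁ v) * B (proj₂ u) (proj₂ v)) (remQuot-combine i k) (remQuot-combine j l)

module _ {n : ℕ} where

  cast-↑ˡ : ∀ (a : Fin n) → cast (n+n≡2*n n) (a ↑ˡ n) ≡ combine {2} 0F a
  cast-↑ˡ a = toℕ-injective (trans (toℕ-cast _ _) (trans (toℕ-↑ˡ a n) (sym (toℕ-↑ˡ a (1 * n)))))

  cast-↑ʳ : ∀ (b : Fin n) → cast (n+n≡2*n n) (n ↑ʳ b) ≡ combine {2} 1F b
  cast-↑ʳ b = toℕ-injective (begin
    toℕ (cast (n+n≡2*n n) (n ↑ʳ b)) ≡⟨ toℕ-cast _ _ ⟩
    toℕ (n ↑ʳ b)                     ≡⟨ toℕ-↑ʳ n b ⟩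
    n + toℕ b                        ≡⟨ cong (n +_) (toℕ-↑ˡ b 0) ⟨
    n + toℕ (b ↑ˡ 0)                 ≡⟨ toℕ-↑ʳ n (b ↑ˡ 0) ⟨
    toℕ (combine {2} 1F b)           ∎)

module _ {n : ℕ} (B : Mat n n) where

  blockDiag-combine : ∀ {x y} p a q b → cast (n+n≡2*n n) x ≡ combine p a → cast (n+n≡2*n n) y ≡ combine q b →
    blockDiag B x y ≡ identity 2 p q * B a b
  blockDiag-combine p a q b x≡pa y≡qb = trans (cong₂ (identity 2 ⊗ₘ B) x≡pa y≡qb) (⊗ₘ-combine (identity 2) B p q a b)

  blockDiag-ˡˡ : ∀ a b → blockDiag B (a ↑ˡ n) (b ↑ˡ n) ≡ B a b
  blockDiag-ˡˡ a b = trans (blockDiag-combine 0F a 0F b (cast-↑ˡ a) (cast-↑ˡ b)) (*-identityˡ (B a b))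

  blockDiag-ˡʳ : ∀ a b → blockDiag B (a ↑ˡ n) (n ↑ʳ b) ≡ 0
  blockDiag-ˡʳ a b = blockDiag-combine 0F a 1F b (cast-↑ˡ a) (cast-↑ʳ b)

  blockDiag-ʳˡ : ∀ a b → blockDiag B (n ↑ʳ a) (b ↑ˡ n) ≡ 0
  blockDiag-ʳˡ a b = blockDiag-combine 1F a 0F b (cast-↑ʳ a) (cast-↑ˡ b)

  blockDiag-ʳʳ : ∀ a b → blockDiag B (n ↑ʳ a) (n ↑ʳ b) ≡ B a b
  blockDiag-ʳʳ a b = trans (blockDiag-combine 1F a 1F b (cast-↑ʳ a) (cast-↑ʳ b)) (*-identityˡ (B a b))

  blockDiag-cross : ∀ x y → isLeft n x ≢ isLeft n y → blockDiag B x y ≡ 0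
  blockDiag-cross x y sides with split n x | split n y
  ... | left a  | left b  = contradiction (trans (isLeft-↑ˡ n a) (sym (isLeft-↑ˡ n b))) sides
  ... | left a  | right b = blockDiag-ˡʳ a b
  ... | right a | left b  = blockDiag-ʳˡ a b
  ... | right a | right b = contradiction (trans (isLeft-↑ʳ n a) (sym (isLeft-↑ʳ n b))) sides

BlockDiagonalises : ∀ n → Graph (n + n) → (Fin (n + n) → Fin (n + n)) → Mat n n → Set
BlockDiagonalises n G ρ B = ∀ i j → adjMatrix G (ρ i) (ρ j) ≡ blockDiag B i j

NoCrossEdges : ∀ n → Graph (n + n) → (Fin (n + n) → Fin (n + n)) → Set
NoCrossEdges n G ρ = ∀ x y → isLeft n x ≢ isLeft n y → adj G (ρ x) (ρ y) ≡ false

EqualBlocks : ∀ n → Graph (n + n) → (Fin (n + n) → Fin (n + n)) → Set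
EqualBlocks n G ρ = ∀ a b → adj G (ρ (a ↑ˡ n)) (ρ (b ↑ˡ n)) ≡ adj G (ρ (n ↑ʳ a)) (ρ (n ↑ʳ b))

module _ {n : ℕ} (G : Graph (n + n)) (ρ : Fin (n + n) → Fin (n + n)) (B : Mat n n)
         (diag : BlockDiagonalises n G ρ B) where

  blockDiagonalises⇒noCrossEdges : NoCrossEdges n G ρ
  blockDiagonalises⇒noCrossEdges x y sides =
    bit-injective _ false (trans (diag x y) (blockDiag-cross B x y sides))

  blockDiagonalises⇒equalBlocks : EqualBlocks n G ρ
  blockDiagonalises⇒equalBlocks a b = bit-injective _ _ (begin
    adjMatrix G (ρ (a ↑ˡ n)) (ρ (b ↑ˡ n)) ≡⟨ diag _ _ ⟩
    blockDiag B (a ↑ˡ n) (b ↑ˡ n)         ≡⟨ blockDiag-ˡˡ B a b ⟩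
    B a b                                 ≡⟨ blockDiag-ʳʳ B a b ⟨
    blockDiag B (n ↑ʳ a) (n ↑ʳ b)         ≡⟨ diag _ _ ⟨
    adjMatrix G (ρ (n ↑ʳ a)) (ρ (n ↑ʳ b)) ∎)

equalBlocks-swap : ∀ {n} (G : Graph (n + n)) (ρ : Fin (n + n) → Fin (n + n)) →
  EqualBlocks n G ρ → EqualBlocks n G (ρ ∘ swapBlocks n n)
equalBlocks-swap {n} G ρ equal a b = begin
  adj G (ρ (swapBlocks n n (a ↑ˡ n))) (ρ (swapBlocks n n (b ↑ˡ n)))
    ≡⟨ cong₂ (adj G) (cong ρ (swapBlocks-↑ˡ a)) (cong ρ (swapBlocks-↑ˡ b)) ⟩
  adj G (ρ (n ↑ʳ a)) (ρ (n ↑ʳ b))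
    ≡⟨ equal a b ⟨
  adj G (ρ (a ↑ˡ n)) (ρ (b ↑ˡ n))
    ≡⟨ cong₂ (adj G) (cong ρ (swapBlocks-↑ʳ a)) (cong ρ (swapBlocks-↑ʳ b)) ⟨
  adj G (ρ (swapBlocks n n (n ↑ʳ a))) (ρ (swapBlocks n n (n ↑ʳ b)))
    ∎

module _ {n : ℕ} {G₁ G₂ : Graph n} (c₁ : Connected G₁) (c₂ : Connected G₂) (T : Permutation′ (n + n))
         (no-cross : NoCrossEdges n (G₁ ∪ᴳ G₂) (T ⟨$⟩ˡ_)) where

  private
    -- T ⟨$⟩ˡ_ sends positions of the relabelled graph to nodes of G₁ ∪ᴳ G₂, so this is the block
    -- in which the node x ends up.
    newSide : Fin (n + n) → Bool
    newSide x = isLeft n (T ⟨$⟩ʳ x)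

    newSide-invariant : ∀ {x y} → adj (G₁ ∪ᴳ G₂) x y ≡ true → newSide x ≡ newSide y
    newSide-invariant {x} {y} edge with newSide x ≟ᵇ newSide y
    ... | yes same     = same
    ... | no different = contradiction (begin
      true                                                 ≡⟨ edge ⟨
      adj (G₁ ∪ᴳ G₂) x y                                   ≡⟨ cong₂ (adj (G₁ ∪ᴳ G₂)) (inverseˡ T) (inverseˡ T) ⟨
      adj (G₁ ∪ᴳ G₂) (T ⟨$⟩ˡ (T ⟨$⟩ʳ x)) (T ⟨$⟩ˡ (T ⟨$⟩ʳ y)) ≡⟨ no-cross _ _ different ⟩
      false                                                ∎) λ ()

    newSide-↑ˡ : ∀ a b → newSide (a ↑ˡ n) ≡ newSide (b ↑ˡ n)
    newSide-↑ˡ a b = reach-invariant (G₁ ∪ᴳ G₂) newSide newSide-invariant (reach-↑ˡ G₁ G₂ (c₁ a b))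

    newSide-↑ʳ : ∀ a b → newSide (n ↑ʳ a) ≡ newSide (n ↑ʳ b)
    newSide-↑ʳ a b = reach-invariant (G₁ ∪ᴳ G₂) newSide newSide-invariant (reach-↑ʳ G₁ G₂ (c₂ a b))

    newSide-separates : ∀ a b → newSide (a ↑ˡ n) ≢ newSide (n ↑ʳ b)
    newSide-separates a b same = contradiction (begin
      true                      ≡⟨ isLeft-↑ˡ n a ⟨
      isLeft n (a ↑ˡ n)         ≡⟨ cong (isLeft n) (inverseʳ T) ⟨
      newSide (T ⟨$⟩ˡ (a ↑ˡ n)) ≡⟨ constant _ ⟩
      newSide (a ↑ˡ n)          ≡⟨ constant _ ⟨
      newSide (T ⟨$⟩ˡ (n ↑ʳ a)) ≡⟨ cong (isLeft n) (inverseʳ T) ⟩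
      isLeft n (n ↑ʳ a)         ≡⟨ isLeft-↑ʳ n a ⟩
      false                     ∎) λ ()
      where
      constant : ∀ x → newSide x ≡ newSide (a ↑ˡ n)
      constant x with split n x
      ... | left c  = newSide-↑ˡ c a
      ... | right c = trans (newSide-↑ʳ c b) (sym same)

    newSide-↑ʳ≡not : ∀ a b → newSide (n ↑ʳ b) ≡ not (newSide (a ↑ˡ n))
    newSide-↑ʳ≡not a b = ¬-not (newSide-separates a b ∘ sym)

  sides-kept-or-swapped : Fin n →
    (∀ x → isLeft n (T ⟨$⟩ʳ x) ≡ isLeft n x) ⊎ (∀ x → isLeft n (T ⟨$⟩ʳ x) ≡ not (isLeft n x))
  sides-kept-or-swapped a with newSide (a ↑ˡ n) in side-a
  ... | true = inj₁ kept
    where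
    kept : ∀ x → newSide x ≡ isLeft n x
    kept x with split n x
    ... | left b  = trans (newSide-↑ˡ b a) (trans side-a (sym (isLeft-↑ˡ n b)))
    ... | right b = trans (newSide-↑ʳ≡not a b) (trans (cong not side-a) (sym (isLeft-↑ʳ n b)))
  ... | false = inj₂ swapped
    where
    swapped : ∀ x → newSide x ≡ not (isLeft n x)
    swapped x with split n x
    ... | left b  = trans (newSide-↑ˡ b a) (trans side-a (cong not (sym (isLeft-↑ˡ n b))))
    ... | right b = trans (newSide-↑ʳ≡not a b) (trans (cong not side-a) (cong not (sym (isLeft-↑ʳ n b))))

sides-kept⇒isomorphic : ∀ {n} (G₁ G₂ : Graph n) (T : Permutation′ (n + n)) →
  (∀ x → isLeft n (T ⟨$⟩ʳ x) ≡ isLeft n x) → EqualBlocks n (G₁ ∪ᴳ G₂) (T ⟨$⟩ˡ_) → Isomorphic G₁ G₂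
sides-kept⇒isomorphic {n} G₁ G₂ T kept equal with side-preserving⇒⊕ₚ T kept
... | σ , τ , T≈σ⊕τ = common-relabelling⇒isomorphic G₁ G₂ (flip σ) (flip τ) λ a b → begin
  adj G₁ (σ ⟨$⟩ˡ a) (σ ⟨$⟩ˡ b)                   ≡⟨ adj-∪ᴳ-ˡˡ G₁ G₂ _ _ ⟨
  adj U ((σ ⟨$⟩ˡ a) ↑ˡ n) ((σ ⟨$⟩ˡ b) ↑ˡ n)      ≡⟨ cong₂ (adj U) (T⁻¹-↑ˡ a) (T⁻¹-↑ˡ b) ⟨
  adj U (T ⟨$⟩ˡ (a ↑ˡ n)) (T ⟨$⟩ˡ (b ↑ˡ n))      ≡⟨ equal a b ⟩
  adj U (T ⟨$⟩ˡ (n ↑ʳ a)) (T ⟨$⟩ˡ (n ↑ʳ b))      ≡⟨ cong₂ (adj U) (T⁻¹-↑ʳ a) (T⁻¹-↑ʳ b) ⟩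
  adj U (n ↑ʳ (τ ⟨$⟩ˡ a)) (n ↑ʳ (τ ⟨$⟩ˡ b))      ≡⟨ adj-∪ᴳ-ʳʳ G₁ G₂ _ _ ⟩
  adj G₂ (τ ⟨$⟩ˡ a) (τ ⟨$⟩ˡ b)                   ∎
  where
  U : Graph (n + n)
  U = G₁ ∪ᴳ G₂
  T⁻¹-↑ˡ : ∀ a → T ⟨$⟩ˡ (a ↑ˡ n) ≡ (σ ⟨$⟩ˡ a) ↑ˡ n
  T⁻¹-↑ˡ a = trans (flip-cong T (σ ⊕ₚ τ) T≈σ⊕τ (a ↑ˡ n)) (blockMap-↑ˡ (σ ⟨$⟩ˡ_) (τ ⟨$⟩ˡ_) a)
  T⁻¹-↑ʳ : ∀ b → T ⟨$⟩ˡ (n ↑ʳ b) ≡ n ↑ʳ (τ ⟨$⟩ˡ b)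
  T⁻¹-↑ʳ b = trans (flip-cong T (σ ⊕ₚ τ) T≈σ⊕τ (n ↑ʳ b)) (blockMap-↑ʳ (σ ⟨$⟩ˡ_) (τ ⟨$⟩ˡ_) b)

blocks-separated⇒isomorphic : ∀ {n} {G₁ G₂ : Graph n} → Connected G₁ → Connected G₂ → (T : Permutation′ (n + n)) →
  NoCrossEdges n (G₁ ∪ᴳ G₂) (T ⟨$⟩ˡ_) → EqualBlocks n (G₁ ∪ᴳ G₂) (T ⟨$⟩ˡ_) → Isomorphic G₁ G₂
blocks-separated⇒isomorphic {zero}  _ _ _ _ _ = Perm.id , λ ()
blocks-separated⇒isomorphic {n@(suc _)} {G₁} {G₂} c₁ c₂ T no-cross equal
  with sides-kept-or-swapped c₁ c₂ T no-cross 0F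
... | inj₁ kept    = sides-kept⇒isomorphic G₁ G₂ T kept equal
... | inj₂ swapped =
  sides-kept⇒isomorphic G₁ G₂ (T ∘ₚ swapₚ {n} {n}) kept (equalBlocks-swap (G₁ ∪ᴳ G₂) (T ⟨$⟩ˡ_) equal)
  where
  kept : ∀ x → isLeft n (swapBlocks n n (T ⟨$⟩ʳ x)) ≡ isLeft n x
  kept x = trans (isLeft-swapBlocks {n} {n} (T ⟨$⟩ʳ x)) (trans (cong not (swapped x)) (not-involutive _))

blockDiagonalises⇒isomorphic : ∀ {n} {G₁ G₂ : Graph n} → Connected G₁ → Connected G₂ →
  (T : Permutation′ (n + n)) (B : Mat n n) → BlockDiagonalises n (G₁ ∪ᴳ G₂) (T ⟨$⟩ˡ_) B → Isomorphic G₁ G₂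
blockDiagonalises⇒isomorphic {G₁ = G₁} {G₂} c₁ c₂ T B diag = blocks-separated⇒isomorphic c₁ c₂ T
  (blockDiagonalises⇒noCrossEdges (G₁ ∪ᴳ G₂) (T ⟨$⟩ˡ_) B diag)
  (blockDiagonalises⇒equalBlocks (G₁ ∪ᴳ G₂) (T ⟨$⟩ˡ_) B diag)

module _ {n : ℕ} (G₁ G₂ : Graph n) (σ : Permutation′ n)
         (iso : ∀ i j → adj G₁ i j ≡ adj G₂ (σ ⟨$⟩ʳ i) (σ ⟨$⟩ʳ j)) where

  private
    U : Graph (n + n)
    U = G₁ ∪ᴳ G₂

    ρ : Fin (n + n) → Fin (n + n)
    ρ = (σ ⊕ₚ Perm.id) ⟨$⟩ˡ_

    ρ-↑ˡ : ∀ a → ρ (a ↑ˡ n) ≡ (σ ⟨$⟩ˡ a) ↑ˡ n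
    ρ-↑ˡ = blockMap-↑ˡ (σ ⟨$⟩ˡ_) id

    ρ-↑ʳ : ∀ b → ρ (n ↑ʳ b) ≡ n ↑ʳ b
    ρ-↑ʳ = blockMap-↑ʳ (σ ⟨$⟩ˡ_) id

  isomorphism⇒blockDiagonalises : BlockDiagonalises n U ρ (adjMatrix G₂)
  isomorphism⇒blockDiagonalises i j with split n i | split n j
  ... | left a  | left b  = begin
    adjMatrix U (ρ (a ↑ˡ n)) (ρ (b ↑ˡ n))                ≡⟨ cong₂ (adjMatrix U) (ρ-↑ˡ a) (ρ-↑ˡ b) ⟩
    adjMatrix U ((σ ⟨$⟩ˡ a) ↑ˡ n) ((σ ⟨$⟩ˡ b) ↑ˡ n)      ≡⟨ cong bit (trans (adj-∪ᴳ-ˡˡ G₁ G₂ _ _) (iso _ _)) ⟩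
    adjMatrix G₂ (σ ⟨$⟩ʳ (σ ⟨$⟩ˡ a)) (σ ⟨$⟩ʳ (σ ⟨$⟩ˡ b)) ≡⟨ cong₂ (adjMatrix G₂) (inverseʳ σ) (inverseʳ σ) ⟩
    adjMatrix G₂ a b                                     ≡⟨ blockDiag-ˡˡ (adjMatrix G₂) a b ⟨
    blockDiag (adjMatrix G₂) (a ↑ˡ n) (b ↑ˡ n)           ∎
  ... | left a  | right b = begin
    adjMatrix U (ρ (a ↑ˡ n)) (ρ (n ↑ʳ b))                ≡⟨ cong₂ (adjMatrix U) (ρ-↑ˡ a) (ρ-↑ʳ b) ⟩
    adjMatrix U ((σ ⟨$⟩ˡ a) ↑ˡ n) (n ↑ʳ b)               ≡⟨ cong bit (adj-∪ᴳ-ˡʳ G₁ G₂ _ b) ⟩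
    0                                                    ≡⟨ blockDiag-ˡʳ (adjMatrix G₂) a b ⟨
    blockDiag (adjMatrix G₂) (a ↑ˡ n) (n ↑ʳ b)           ∎
  ... | right a | left b  = begin
    adjMatrix U (ρ (n ↑ʳ a)) (ρ (b ↑ˡ n))                ≡⟨ cong₂ (adjMatrix U) (ρ-↑ʳ a) (ρ-↑ˡ b) ⟩
    adjMatrix U (n ↑ʳ a) ((σ ⟨$⟩ˡ b) ↑ˡ n)               ≡⟨ cong bit (adj-∪ᴳ-ʳˡ G₁ G₂ a _) ⟩
    0                                                    ≡⟨ blockDiag-ʳˡ (adjMatrix G₂) a b ⟨
    blockDiag (adjMatrix G₂) (n ↑ʳ a) (b ↑ˡ n)           ∎
  ... | right a | right b = begin
    adjMatrix U (ρ (n ↑ʳ a)) (ρ (n ↑ʳ b))                ≡⟨ cong₂ (adjMatrix U) (ρ-↑ʳ a) (ρ-↑ʳ b) ⟩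
    adjMatrix U (n ↑ʳ a) (n ↑ʳ b)                        ≡⟨ cong bit (adj-∪ᴳ-ʳʳ G₁ G₂ a b) ⟩
    adjMatrix G₂ a b                                     ≡⟨ blockDiag-ʳʳ (adjMatrix G₂) a b ⟨
    blockDiag (adjMatrix G₂) (n ↑ʳ a) (n ↑ʳ b)           ∎

lemma1 : ∀ (n : ℕ) (G₁ G₂ : Graph n) → Connected G₁ → Connected G₂ →
    Isomorphic G₁ G₂ ⇔
      Σ (Mat (n + n) (n + n)) (λ P → Σ (Mat n n) (λ B →
        IsPermutationMatrix P × Binary B ×
        (∀ (i j : Fin (n + n)) → ((transpose P ·ₘ adjMatrix (G₁ ∪ᴳ G₂)) ·ₘ P) i j
                 ≡ (identity 2 ⊗ₘ B) (cast (n+n≡2*n n) i) (cast (n+n≡2*n n) j))))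
lemma1 n G₁ G₂ c₁ c₂ = mk⇔
  (λ { (σ , iso) → let T = σ ⊕ₚ Perm.id in
       permMatrix T , adjMatrix G₂ , (T , λ _ _ → refl) , adjMatrix-binary G₂ , λ i j →
         trans (conjugate-permMatrix T (λ _ _ → refl) M i j) (isomorphism⇒blockDiagonalises G₁ G₂ σ iso i j) })
  (λ { (P , B , (T , P≡T) , _ , PᵀMP≡I₂⊗B) → blockDiagonalises⇒isomorphic c₁ c₂ T B λ i j →
       trans (sym (conjugate-permMatrix T P≡T M i j)) (PᵀMP≡I₂⊗B i j) })
  where
  M : Mat (n + n) (n + n)
  M = adjMatrix (G₁ ∪ᴳ G₂)
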